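{- Let $k\in\mathbb{N}$ and let $G$ be a graph. If $H$ is a graph that covers all cycles of $G$ and $H$ is equitably $k$-choosable, then $G$ is equitably $k$-list arborable.
   Context: A graph $H$ covers all cycles of $G$ if $H$ is a spanning subgraph of $G$ (a subgraph with $V(H)=V(G)$) and for every cycle $C$ of $G$ there are $x,y\in V(C)$ with $xy\in E(H)$. A $k$-uniform list assignment $L$ assigns to each vertex $v$ a set $L(v)$ of exactly $k$ colours; an $L$-colouring is a map $c$ with $c(v)\in L(v)$; it is proper if adjacent vertices get different colours and equitable if every colour class has at most $\lceil |V|/k\rceil$ vertices. A graph is equitably $k$-choosable if for every $k$-uniform list assignment there is an equitable proper $L$-colouring; it is equitably $k$-list arborable if for every $k$-uniform list assignment there is an equitable $L$-colouring in which every colour class induces an acyclic subgraph. -}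

module Defs where

open import Data.Nat using (ℕ; zero; suc; _+_; _≤_)
open import Data.Nat.DivMod using (_/_)
open import Data.Bool using (Bool; true; false)
open import Data.Fin using (Fin; zero; suc; inject₁; fromℕ)
open import Data.List using (List; length; filter)
open import Data.List.Membership.Propositional using (_∈_)
open import Data.List.Relation.Unary.Unique.Propositional using (Unique)
open import Data.Nat.Properties using (_≟_)
open import Data.Product using (Σ; ∃; _×_; _,_)
open import Function.Definitions using (Injective)
open import Relation.Binary.PropositionalEquality using (_≡_; _≢_)
open import Relation.Nullary using (¬_)
open import Data.List using (allFin)

record Graph (n : ℕ) : Set where
  field
    adj   : Fin n → Fin n → Bool
    sym   : ∀ x y → adj x y ≡ true → adj y x ≡ true
    irrefl : ∀ x → adj x x ≡ false
open Graph public

Adj : ∀ {n} → Graph n → Fin n → Fin n → Set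
Adj G x y = adj G x y ≡ true

-- A cycle of G: distinct vertices v₀,…,v_{m-1} with m = len + 3 ≥ 3,
-- vᵢ adjacent to vᵢ₊₁ and v_{m-1} adjacent to v₀.
record Cycle {n : ℕ} (G : Graph n) : Set where
  field
    len     : ℕ
    vert    : Fin (suc (suc (suc len))) → Fin n
    distinct : Injective _≡_ _≡_ vert
    step    : ∀ (i : Fin (suc (suc len))) → Adj G (vert (inject₁ i)) (vert (suc i))
    close   : Adj G (vert (fromℕ (suc (suc len)))) (vert zero)
open Cycle public

SpanningSubgraph : ∀ {n} → Graph n → Graph n → Set
SpanningSubgraph H G = ∀ x y → Adj H x y → Adj G x y

CoversAllCycles : ∀ {n} → Graph n → Graph n → Set
CoversAllCycles {n} H G =
  SpanningSubgraph H G ×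
  (∀ (C : Cycle G) → Σ (Fin (suc (suc (suc (len C))))) λ i →
                     Σ (Fin (suc (suc (suc (len C))))) λ j →
                     Adj H (vert C i) (vert C j))

Uniform : ∀ (n k : ℕ) → (Fin n → List ℕ) → Set
Uniform n k L = ∀ v → Unique (L v) × length (L v) ≡ k

IsLColouring : ∀ {n} → (Fin n → List ℕ) → (Fin n → ℕ) → Set
IsLColouring L c = ∀ v → c v ∈ L v

Proper : ∀ {n} → Graph n → (Fin n → ℕ) → Set
Proper G c = ∀ x y → Adj G x y → c x ≢ c y

-- ⌈ n / k ⌉ (k = 0 never matters: then no L-colouring exists unless n = 0)
ceilDiv : ℕ → ℕ → ℕ
ceilDiv n zero = zero
ceilDiv n (suc k) = (n + k) / suc k

classSize : ∀ {n} → (Fin n → ℕ) → ℕ → ℕ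
classSize {n} c a = length (filter (λ v → c v ≟ a) (allFin n))

Equitable : ∀ {n} → ℕ → (Fin n → ℕ) → Set
Equitable {n} k c = ∀ a → classSize c a ≤ ceilDiv n k

-- every colour class induces an acyclic subgraph of G:
-- no cycle of G has all its vertices in one colour class.
ClassesAcyclic : ∀ {n} → Graph n → (Fin n → ℕ) → Set
ClassesAcyclic G c = ∀ (a : ℕ) (C : Cycle G) → ¬ (∀ i → c (vert C i) ≡ a)

EquitablyChoosable : ∀ {n} → ℕ → Graph n → Set
EquitablyChoosable {n} k G = ∀ (L : Fin n → List ℕ) → Uniform n k L →
  ∃ λ (c : Fin n → ℕ) → IsLColouring L c × Proper G c × Equitable k c

EquitablyListArborable : ∀ {n} → ℕ → Graph n → Set
EquitablyListArborable {n} k G = ∀ (L : Fin n → List ℕ) → Uniform n k L →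
  ∃ λ (c : Fin n → ℕ) → IsLColouring L c × ClassesAcyclic G c × Equitable k c

-- A proper colouring of a graph H that covers all cycles of G has acyclic
-- colour classes in G: every cycle of G contains an edge xy of H, and
-- properness of the colouring on H gives x and y different colours, so no
-- cycle of G is monochromatic.  Being an L-colouring and being equitable do
-- not refer to the graph at all, so an equitable proper L-colouring of H is
-- already an equitable L-colouring of G with acyclic classes.
module Submission where

open import Defs
open import Data.Nat using (ℕ)
open import Data.Fin using (Fin)
open import Data.Product using (_,_)
open import Relation.Binary.PropositionalEquality using (trans) renaming (sym to ≡-sym)

proper-on-cover⇒classesAcyclic : ∀ {n} (G H : Graph n) (c : Fin n → ℕ) →
  CoversAllCycles H G → Proper H c → ClassesAcyclic G c
proper-on-cover⇒classesAcyclic G H c (_ , covers) proper a C monochromatic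
  with covers C
... | i , j , xy∈H = proper _ _ xy∈H (trans (monochromatic i) (≡-sym (monochromatic j)))

lemma8 : ∀ (k n : ℕ) (G H : Graph n) →
    CoversAllCycles H G → EquitablyChoosable k H → EquitablyListArborable k G
lemma8 k n G H cover choosable L uniform with choosable L uniform
... | c , isLColouring , proper , equitable =
  c , isLColouring , proper-on-cover⇒classesAcyclic G H c cover proper , equitable
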